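{- Let $q$ be a prime and let $(V,\mathcal{L})$ be the hypergraph obtained from the affine plane of order $q$ by deleting all $q$ lines of one parallel class (vertices are the $q^2$ points, hyperedges are the remaining $q^2$ lines). Then $(V,\mathcal{L})$ is a $q$-uniform, $q$-regular hypergraph on $q^2$ vertices satisfying: (P1) any two vertices are contained in at most one hyperedge; (P2) for every $A\subseteq V$ with $|A|=q$, the number of hyperedges $L\in\mathcal{L}$ with $L\cap A\neq\emptyset$ is at least $q^2/2$.
   Context: The affine plane of order $q$ is an incidence structure of $q^2$ points and $q^2+q$ lines such that any two points lie on a unique line, every line contains $q$ points and every point lies on $q+1$ lines; its lines split into $q+1$ parallel classes, each consisting of $q$ pairwise disjoint lines. -}

module Defs where

open import Data.Nat using (ℕ; NonZero; _≟_; _*_; _+_)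
open import Data.Nat.DivMod using (_%_)
open import Data.Fin using (Fin; toℕ)
open import Data.Product using (_×_; _,_)
open import Data.Bool using (Bool; _∧_)
open import Data.List using (List; length; filterᵇ; allFin; cartesianProduct)
open import Data.Bool.ListAction using (any)
open import Relation.Binary.PropositionalEquality using (_≡_)
open import Relation.Nullary.Decidable using (⌊_⌋)

-- The Desarguesian affine plane AG(2,q) over ℤ/qℤ (a field for q prime).
-- Points are pairs (x , y) with x y ∈ ℤ/qℤ.
Point : ℕ → Set
Point q = Fin q × Fin q

-- Remaining lines after deleting the parallel class of vertical lines
-- {x = c}: the non-vertical lines y = m x + b, indexed by (m , b).
-- There are exactly q² of them.
Line : ℕ → Set
Line q = Fin q × Fin q

_∈L_ : ∀ {q} .{{_ : NonZero q}} → Point q → Line q → Set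
_∈L_ {q} (x , y) (m , b) = toℕ y ≡ (toℕ m * toℕ x + toℕ b) % q

inc : ∀ {q} .{{_ : NonZero q}} → Point q → Line q → Bool
inc {q} (x , y) (m , b) = ⌊ toℕ y ≟ (toℕ m * toℕ x + toℕ b) % q ⌋

points : (q : ℕ) → List (Point q)
points q = cartesianProduct (allFin q) (allFin q)

lines : (q : ℕ) → List (Line q)
lines q = cartesianProduct (allFin q) (allFin q)

count : ∀ {A : Set} → (A → Bool) → List A → ℕ
count p xs = length (filterᵇ p xs)

card : ∀ {q} → (Point q → Bool) → ℕ
card {q} A = count A (points q)

hitting : ∀ {q} .{{_ : NonZero q}} → (Point q → Bool) → ℕ
hitting {q} A = count (λ L → any (λ p → A p ∧ inc p L) (points q)) (lines q)

degree : ∀ {q} .{{_ : NonZero q}} → Point q → ℕ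
degree {q} p = count (inc p) (lines q)

size : ∀ {q} .{{_ : NonZero q}} → Line q → ℕ
size {q} L = count (λ p → inc p L) (points q)

-- Over ℤ/qℤ with q prime, a line y = m x + b is determined by two of its points with
-- distinct abscissae: the difference of ordinates is m (x′ − x), and x′ − x is invertible.
-- So the q² non-vertical lines form a linear q-regular hypergraph. In such a hypergraph a
-- point p of a set S lies on r lines, at most |S| − 1 of which already meet S ∖ {p};
-- inductively S meets at least |S| r − |S| choose 2 lines, which for |S| = r = q is
-- q (q + 1) / 2 ≥ q² / 2.
module Submission where

open import Defs
open import Data.Bool using (Bool; true; false; T; _∧_; _∨_)
open import Data.Bool.ListAction using (any)
open import Data.Bool.Properties using (∧-distribˡ-∨; ∧-zeroʳ; T-∧)
open import Data.Fin using (Fin; toℕ; fromℕ<)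
open import Data.Fin.Properties using (toℕ-injective; toℕ<n; toℕ-fromℕ<)
open import Data.List using (List; []; _∷_; _++_; map; length; filterᵇ; allFin; cartesianProduct)
open import Data.List.Properties using (filter-++; filter-≐; length-++; length-tabulate)
open import Data.List.Membership.Propositional using (_∈_)
open import Data.List.Membership.Propositional.Properties using (∈-filter⁺; ∈-filter⁻; ∈-allFin)
open import Data.List.Relation.Unary.All using (All; []; _∷_)
open import Data.List.Relation.Unary.Any using (here; there)
open import Data.List.Relation.Unary.AllPairs using ([]; _∷_)
open import Data.List.Relation.Unary.Unique.Propositional using (Unique)
open import Data.List.Relation.Unary.Unique.Propositional.Properties
  using (filter⁺; cartesianProduct⁺; allFin⁺)
open import Data.Nat
open import Data.Nat.Combinatorics using (_C_; nC1≡n; nCk+nC[k+1]≡[n+1]C[k+1])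
open import Data.Nat.DivMod
open import Data.Nat.Divisibility using (_∣_; divides; >⇒∤)
open import Data.Nat.Primality using (Prime; euclidsLemma)
open import Data.Nat.Properties
open import Data.Nat.Tactic.RingSolver using (solve-∀)
open import Data.Product using (_×_; _,_; proj₂)
open import Data.Sum using (inj₁; inj₂)
open import Function using (_∘_)
open import Function.Bundles using (Equivalence)
open import Relation.Binary.Definitions using (tri<; tri≈; tri>)
open import Relation.Binary.PropositionalEquality
open import Relation.Nullary using (¬_; contradiction)
open import Relation.Nullary.Decidable using (toWitness; fromWitness; T?)

module _ {q : ℕ} .{{_ : NonZero q}} where

  [m%d+n]%d≡[m+n]%d : ∀ m n → (m % q + n) % q ≡ (m + n) % q
  [m%d+n]%d≡[m+n]%d m n = begin
    (m % q + n) % q          ≡⟨ %-distribˡ-+ (m % q) n q ⟩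
    (m % q % q + n % q) % q  ≡⟨ cong (λ z → (z + n % q) % q) (m%n%n≡m%n m q) ⟩
    (m % q + n % q) % q      ≡⟨ %-distribˡ-+ m n q ⟨
    (m + n) % q              ∎
    where open ≡-Reasoning

  [m+n%d]%d≡[m+n]%d : ∀ m n → (m + n % q) % q ≡ (m + n) % q
  [m+n%d]%d≡[m+n]%d m n = begin
    (m + n % q) % q  ≡⟨ cong (_% q) (+-comm m (n % q)) ⟩
    (n % q + m) % q  ≡⟨ [m%d+n]%d≡[m+n]%d n m ⟩
    (n + m) % q      ≡⟨ cong (_% q) (+-comm n m) ⟩
    (m + n) % q      ∎
    where open ≡-Reasoning

  %≡⇒∣∸ : ∀ {m n} → m ≤ n → m % q ≡ n % q → q ∣ n ∸ m
  %≡⇒∣∸ {m} {n} m≤n eq = divides (n / q ∸ m / q) (begin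
    n ∸ m                                        ≡⟨ cong₂ _∸_ (m≡m%n+[m/n]*n n q) (m≡m%n+[m/n]*n m q) ⟩
    (n % q + n / q * q) ∸ (m % q + m / q * q)    ≡⟨ cong (λ z → (n % q + n / q * q) ∸ (z + m / q * q)) eq ⟩
    (n % q + n / q * q) ∸ (n % q + m / q * q)    ≡⟨ [m+n]∸[m+o]≡n∸o (n % q) _ _ ⟩
    n / q * q ∸ m / q * q                        ≡⟨ *-distribʳ-∸ q (n / q) (m / q) ⟨
    (n / q ∸ m / q) * q                          ∎)
    where open ≡-Reasoning

  ∣∸⇒%≡ : ∀ {m n} → m ≤ n → q ∣ n ∸ m → m % q ≡ n % q
  ∣∸⇒%≡ {m} {n} m≤n q∣n∸m = begin
    m % q                ≡⟨ %-remove-+ʳ m q∣n∸m ⟨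
    (m + (n ∸ m)) % q    ≡⟨ cong (_% q) (m+[n∸m]≡n m≤n) ⟩
    n % q                ∎
    where open ≡-Reasoning

  %≡-wlog : {R : ℕ → ℕ → Set} → (∀ {m n} → R m n → R n m) →
            (∀ {m n} → m ≤ n → R m n → q ∣ n ∸ m) →
            ∀ {m n} → R m n → m % q ≡ n % q
  %≡-wlog R-sym R⇒∣∸ {m} {n} r with ≤-total m n
  ... | inj₁ m≤n = ∣∸⇒%≡ m≤n (R⇒∣∸ m≤n r)
  ... | inj₂ n≤m = sym (∣∸⇒%≡ n≤m (R⇒∣∸ n≤m (R-sym r)))

  +-cancelˡ-%≡ : ∀ c {m n} → (c + m) % q ≡ (c + n) % q → m % q ≡ n % q
  +-cancelˡ-%≡ c = %≡-wlog sym λ {m} {n} m≤n eq →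
    subst (q ∣_) ([m+n]∸[m+o]≡n∸o c n m) (%≡⇒∣∸ (+-monoʳ-≤ c m≤n) eq)

  *-cancelʳ-%≡ : ∀ {d m n} → Prime q → ¬ q ∣ d → (m * d) % q ≡ (n * d) % q → m % q ≡ n % q
  *-cancelʳ-%≡ {d} q-prime q∤d = %≡-wlog sym q∣∸
    where
    q∣∸ : ∀ {m n} → m ≤ n → (m * d) % q ≡ (n * d) % q → q ∣ n ∸ m
    q∣∸ {m} {n} m≤n eq
      with euclidsLemma (n ∸ m) d q-prime
             (subst (q ∣_) (sym (*-distribʳ-∸ d n m)) (%≡⇒∣∸ (*-monoˡ-≤ d m≤n) eq))
    ... | inj₁ q∣n∸m = q∣n∸m
    ... | inj₂ q∣d   = contradiction q∣d q∤d

  +-solve-% : ∀ k n → (k + (n + (q ∸ k % q)) % q) % q ≡ n % q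
  +-solve-% k n = begin
    (k + (n + (q ∸ k % q)) % q) % q  ≡⟨ [m+n%d]%d≡[m+n]%d k _ ⟩
    (k + (n + (q ∸ k % q))) % q      ≡⟨ [m%d+n]%d≡[m+n]%d k _ ⟨
    (k % q + (n + (q ∸ k % q))) % q  ≡⟨ cong (_% q) (x+[y+z]≡y+[x+z] (k % q) n _) ⟩
    (n + (k % q + (q ∸ k % q))) % q  ≡⟨ cong (λ z → (n + z) % q) (m+[n∸m]≡n (m%n≤n k q)) ⟩
    (n + q) % q                      ≡⟨ [m+n]%n≡m%n n q ⟩
    n % q                            ∎
    where
    open ≡-Reasoning
    x+[y+z]≡y+[x+z] : ∀ x y z → x + (y + z) ≡ y + (x + z)
    x+[y+z]≡y+[x+z] = solve-∀

  toℕ-%≡⇒≡ : {i j : Fin q} → toℕ i % q ≡ toℕ j % q → i ≡ j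
  toℕ-%≡⇒≡ {i} {j} eq =
    toℕ-injective (trans (sym (m<n⇒m%n≡m (toℕ<n i))) (trans eq (m<n⇒m%n≡m (toℕ<n j))))

module _ {A : Set} where

  count-++ : ∀ (f : A → Bool) xs ys → count f (xs ++ ys) ≡ count f xs + count f ys
  count-++ f xs ys = trans (cong length (filter-++ (T? ∘ f) xs ys)) (length-++ (filterᵇ f xs))

  count-cong : ∀ {f g : A → Bool} → (∀ x → f x ≡ g x) → ∀ xs → count f xs ≡ count g xs
  count-cong {f} {g} f≗g xs =
    cong length (filter-≐ (T? ∘ f) (T? ∘ g) ((λ {x} → subst T (f≗g x)) , (λ {x} → subst T (sym (f≗g x)))) xs)

  count-false : ∀ xs → count (λ (_ : A) → false) xs ≡ 0
  count-false []       = refl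
  count-false (_ ∷ xs) = count-false xs

  count-∨+count-∧ : ∀ (f g : A → Bool) xs →
    count (λ x → f x ∨ g x) xs + count (λ x → f x ∧ g x) xs ≡ count f xs + count g xs
  count-∨+count-∧ f g []       = refl
  count-∨+count-∧ f g (x ∷ xs) with f x | g x | count-∨+count-∧ f g xs
  ... | true  | true  | ih = cong suc (trans (+-suc _ _) (trans (cong suc ih) (sym (+-suc _ _))))
  ... | true  | false | ih = cong suc ih
  ... | false | true  | ih = trans (cong suc ih) (sym (+-suc _ _))
  ... | false | false | ih = ih

  count-∨-≤ : ∀ (f g : A → Bool) xs → count (λ x → f x ∨ g x) xs ≤ count f xs + count g xs
  count-∨-≤ f g xs = subst (count (λ x → f x ∨ g x) xs ≤_) (count-∨+count-∧ f g xs) (m≤m+n _ _)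

  count-≤1 : ∀ (f : A → Bool) {xs} → Unique xs → (∀ {x y} → T (f x) → T (f y) → x ≡ y) → count f xs ≤ 1
  count-≤1 f {xs} u f-subsingleton = length≤1 (filter⁺ (T? ∘ f) u) λ x∈ y∈ →
    f-subsingleton (proj₂ (∈-filter⁻ (T? ∘ f) {xs = xs} x∈)) (proj₂ (∈-filter⁻ (T? ∘ f) {xs = xs} y∈))
    where
    length≤1 : ∀ {ys} → Unique ys → (∀ {x y} → x ∈ ys → y ∈ ys → x ≡ y) → length ys ≤ 1
    length≤1 []                    _ = z≤n
    length≤1 (_ ∷ [])              _ = s≤s z≤n
    length≤1 ((x≢y ∷ _) ∷ _ ∷ _) eq = contradiction (eq (here refl) (there (here refl))) x≢y

  count≡1 : ∀ (f : A → Bool) {xs x} → Unique xs → x ∈ xs → T (f x) →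
            (∀ {y} → T (f y) → y ≡ x) → count f xs ≡ 1
  count≡1 f u x∈xs fx unique = ≤-antisym (count-≤1 f u λ fy fz → trans (unique fy) (sym (unique fz)))
                                          (nonempty (∈-filter⁺ (T? ∘ f) x∈xs fx))
    where
    nonempty : ∀ {y ys} → y ∈ ys → 1 ≤ length ys
    nonempty (here _)  = s≤s z≤n
    nonempty (there _) = s≤s z≤n

  count-map : ∀ {B : Set} (f : B → Bool) (g : A → B) xs → count f (map g xs) ≡ count (f ∘ g) xs
  count-map f g []       = refl
  count-map f g (x ∷ xs) with f (g x)
  ... | true  = cong suc (count-map f g xs)
  ... | false = count-map f g xs

  any-filterᵇ : ∀ (P g : A → Bool) xs → any (λ x → P x ∧ g x) xs ≡ any g (filterᵇ P xs)
  any-filterᵇ P g []       = refl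
  any-filterᵇ P g (x ∷ xs) with P x
  ... | true  = cong (g x ∨_) (any-filterᵇ P g xs)
  ... | false = any-filterᵇ P g xs

module _ {A B : Set} where

  count-cartesianProduct : ∀ (f : A × B → Bool) {k} xs ys → (∀ x → count (λ y → f (x , y)) ys ≡ k) →
                           count f (cartesianProduct xs ys) ≡ length xs * k
  count-cartesianProduct f []       ys fibre = refl
  count-cartesianProduct f (x ∷ xs) ys fibre = begin
    count f (map (x ,_) ys ++ cartesianProduct xs ys)           ≡⟨ count-++ f (map (x ,_) ys) _ ⟩
    count f (map (x ,_) ys) + count f (cartesianProduct xs ys)  ≡⟨ cong₂ _+_ (trans (count-map f (x ,_) ys) (fibre x))
                                                                             (count-cartesianProduct f xs ys fibre) ⟩
    _ + length xs * _                                           ∎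
    where open ≡-Reasoning

module LinearHypergraph {P L : Set} (incident : P → L → Bool) (ls : List L) where

  hits : List P → ℕ
  hits ps = count (λ l → any (λ p → incident p l) ps) ls

  module _ {r : ℕ} (degree≡r : ∀ p → count (incident p) ls ≡ r)
           (common≤1 : ∀ {p p′} → p ≢ p′ → count (λ l → incident p l ∧ incident p′ l) ls ≤ 1) where

    common-with≤ : ∀ p ps → All (p ≢_) ps →
                   count (λ l → incident p l ∧ any (λ s → incident s l) ps) ls ≤ length ps
    common-with≤ p []       [] =
      ≤-reflexive (trans (count-cong (λ l → ∧-zeroʳ (incident p l)) ls) (count-false ls))
    common-with≤ p (s ∷ ps) (p≢s ∷ p∉ps) = begin
      count (λ l → incident p l ∧ (incident s l ∨ any′ l)) ls
        ≡⟨ count-cong (λ l → ∧-distribˡ-∨ (incident p l) (incident s l) (any′ l)) ls ⟩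
      count (λ l → (incident p l ∧ incident s l) ∨ (incident p l ∧ any′ l)) ls
        ≤⟨ count-∨-≤ (λ l → incident p l ∧ incident s l) _ ls ⟩
      count (λ l → incident p l ∧ incident s l) ls + count (λ l → incident p l ∧ any′ l) ls
        ≤⟨ +-mono-≤ (common≤1 p≢s) (common-with≤ p ps p∉ps) ⟩
      suc (length ps) ∎
      where
      open ≤-Reasoning
      any′ : L → Bool
      any′ l = any (λ s → incident s l) ps

    hits-lowerBound : ∀ ps → Unique ps → length ps * r ≤ hits ps + length ps C 2
    hits-lowerBound []       []           = z≤n
    hits-lowerBound (p ∷ ps) (p∉ps ∷ u) = begin
      r + n * r                    ≤⟨ +-monoʳ-≤ r (hits-lowerBound ps u) ⟩
      r + (hits ps + n C 2)        ≡⟨ +-assoc r (hits ps) (n C 2) ⟨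
      r + hits ps + n C 2          ≡⟨ cong (_+ n C 2) inclusion–exclusion ⟨
      hits (p ∷ ps) + I + n C 2    ≤⟨ +-monoˡ-≤ (n C 2) (+-monoʳ-≤ (hits (p ∷ ps)) (common-with≤ p ps p∉ps)) ⟩
      hits (p ∷ ps) + n + n C 2    ≡⟨ +-assoc (hits (p ∷ ps)) n (n C 2) ⟩
      hits (p ∷ ps) + (n + n C 2)  ≡⟨ cong (hits (p ∷ ps) +_) pascal ⟩
      hits (p ∷ ps) + suc n C 2    ∎
      where
      open ≤-Reasoning
      n = length ps
      I = count (λ l → incident p l ∧ any (λ s → incident s l) ps) ls
      inclusion–exclusion : hits (p ∷ ps) + I ≡ r + hits ps
      inclusion–exclusion = trans (count-∨+count-∧ (incident p) (λ l → any (λ s → incident s l) ps) ls)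
                                  (cong (_+ hits ps) (degree≡r p))
      pascal : n + n C 2 ≡ suc n C 2
      pascal = trans (cong (_+ n C 2) (sym (nC1≡n n))) (nCk+nC[k+1]≡[n+1]C[k+1] n 1)

2*nC2+n≡n*n : ∀ n → 2 * (n C 2) + n ≡ n * n
2*nC2+n≡n*n zero    = refl
2*nC2+n≡n*n (suc n) = begin
  2 * (suc n C 2) + suc n         ≡⟨ cong (λ c → 2 * c + suc n) (nCk+nC[k+1]≡[n+1]C[k+1] n 1) ⟨
  2 * (n C 1 + n C 2) + suc n     ≡⟨ cong (λ c → 2 * (c + n C 2) + suc n) (nC1≡n n) ⟩
  2 * (n + n C 2) + suc n         ≡⟨ regroup n (n C 2) ⟩
  (2 * (n C 2) + n) + (2 * n + 1) ≡⟨ cong (_+ (2 * n + 1)) (2*nC2+n≡n*n n) ⟩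
  n * n + (2 * n + 1)             ≡⟨ square-suc n ⟩
  suc n * suc n                   ∎
  where
  open ≡-Reasoning
  regroup : ∀ n c → 2 * (n + c) + suc n ≡ (2 * c + n) + (2 * n + 1)
  regroup = solve-∀
  square-suc : ∀ n → n * n + (2 * n + 1) ≡ suc n * suc n
  square-suc = solve-∀

m≤n+o∧2o≤m⇒m≤2n : ∀ {m n o} → m ≤ n + o → 2 * o ≤ m → m ≤ 2 * n
m≤n+o∧2o≤m⇒m≤2n {m} {n} {o} m≤n+o 2o≤m = +-cancelʳ-≤ m m (2 * n) (begin
  m + m              ≤⟨ +-mono-≤ m≤n+o m≤n+o ⟩
  (n + o) + (n + o)  ≡⟨ regroup n o ⟩
  2 * n + 2 * o      ≤⟨ +-monoʳ-≤ (2 * n) 2o≤m ⟩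
  2 * n + m          ∎)
  where
  open ≤-Reasoning
  regroup : ∀ n o → (n + o) + (n + o) ≡ 2 * n + 2 * o
  regroup = solve-∀

module _ {q : ℕ} .{{_ : NonZero q}} where

  count-grid≡q : (f : Fin q × Fin q → Bool) → (∀ i → count (λ j → f (i , j)) (allFin q) ≡ 1) →
                 count f (cartesianProduct (allFin q) (allFin q)) ≡ q
  count-grid≡q f fibre = begin
    count f (cartesianProduct (allFin q) (allFin q)) ≡⟨ count-cartesianProduct f (allFin q) (allFin q) fibre ⟩
    length (allFin q) * 1                            ≡⟨ *-identityʳ _ ⟩
    length (allFin q)                                ≡⟨ length-tabulate (λ i → i) ⟩
    q                                                ∎
    where open ≡-Reasoning

  grid-unique : Unique (cartesianProduct (allFin q) (allFin q))
  grid-unique = cartesianProduct⁺ (allFin⁺ q) (allFin⁺ q)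

  count-allFin≡1 : (f : Fin q → Bool) (i : Fin q) → T (f i) → (∀ {j} → T (f j) → j ≡ i) →
                   count f (allFin q) ≡ 1
  count-allFin≡1 f i = count≡1 f (allFin⁺ q) (∈-allFin i)

  size≡q : (L : Line q) → size L ≡ q
  size≡q (m , b) = count-grid≡q (λ p → inc p (m , b)) one-ordinate
    where
    one-ordinate : ∀ x → count (λ y → inc (x , y) (m , b)) (allFin q) ≡ 1
    one-ordinate x = count-allFin≡1 _ y (fromWitness (toℕ-fromℕ< y<q))
                       (λ t → toℕ-injective (trans (toWitness t) (sym (toℕ-fromℕ< y<q))))
      where
      y<q = m%n<n (toℕ m * toℕ x + toℕ b) q
      y   = fromℕ< y<q

  degree≡q : (p : Point q) → degree p ≡ q
  degree≡q (x , y) = count-grid≡q (inc (x , y)) one-intercept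
    where
    one-intercept : ∀ m → count (λ b → inc (x , y) (m , b)) (allFin q) ≡ 1
    one-intercept m = count-allFin≡1 _ b (fromWitness on-line)
                        (λ t → toℕ-%≡⇒≡ (+-cancelˡ-%≡ k (trans (sym (toWitness t)) on-line)))
      where
      k   = toℕ m * toℕ x
      b<q = m%n<n (toℕ y + (q ∸ k % q)) q
      b   = fromℕ< b<q
      on-line : toℕ y ≡ (k + toℕ b) % q
      on-line = begin
        toℕ y                                ≡⟨ m<n⇒m%n≡m (toℕ<n y) ⟨
        toℕ y % q                            ≡⟨ +-solve-% k (toℕ y) ⟨
        (k + (toℕ y + (q ∸ k % q)) % q) % q  ≡⟨ cong (λ z → (k + z) % q) (toℕ-fromℕ< b<q) ⟨
        (k + toℕ b) % q                      ∎
        where open ≡-Reasoning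

  ∈L-step : ∀ {x x′ y y′ m b} → toℕ x ≤ toℕ x′ → (x , y) ∈L (m , b) → (x′ , y′) ∈L (m , b) →
            (toℕ y + toℕ m * (toℕ x′ ∸ toℕ x)) % q ≡ toℕ y′
  ∈L-step {x} {x′} {y} {y′} {m} {b} x≤x′ on on′ = begin
    (toℕ y + M * D) % q                ≡⟨ cong (λ z → (z + M * D) % q) on ⟩
    ((M * toℕ x + B) % q + M * D) % q  ≡⟨ [m%d+n]%d≡[m+n]%d (M * toℕ x + B) (M * D) ⟩
    (M * toℕ x + B + M * D) % q        ≡⟨ cong (_% q) (regroup M (toℕ x) B D) ⟩
    (M * (toℕ x + D) + B) % q          ≡⟨ cong (λ z → (M * z + B) % q) (m+[n∸m]≡n x≤x′) ⟩
    (M * toℕ x′ + B) % q               ≡⟨ on′ ⟨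
    toℕ y′                             ∎
    where
    open ≡-Reasoning
    M = toℕ m
    B = toℕ b
    D = toℕ x′ ∸ toℕ x
    regroup : ∀ m x b d → m * x + b + m * d ≡ m * (x + d) + b
    regroup = solve-∀

  line-through-two-columns : Prime q → ∀ {x x′ y y′ L L′} → toℕ x < toℕ x′ →
    (x , y) ∈L L → (x′ , y′) ∈L L → (x , y) ∈L L′ → (x′ , y′) ∈L L′ → L ≡ L′
  line-through-two-columns q-prime {x} {x′} {y} {L = m , b} {m′ , b′} x<x′ on₁ on₂ on₁′ on₂′ =
    cong₂ _,_ m≡m′ b≡b′
    where
    d = toℕ x′ ∸ toℕ x
    q∤d : ¬ q ∣ d
    q∤d = >⇒∤ {{>-nonZero (m<n⇒0<n∸m x<x′)}} (≤-<-trans (m∸n≤m (toℕ x′) (toℕ x)) (toℕ<n x′))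
    m≡m′ : m ≡ m′
    m≡m′ = toℕ-%≡⇒≡ (*-cancelʳ-%≡ q-prime q∤d (+-cancelˡ-%≡ (toℕ y)
             (trans (∈L-step {m = m} {b} (<⇒≤ x<x′) on₁ on₂) (sym (∈L-step {m = m′} {b′} (<⇒≤ x<x′) on₁′ on₂′)))))
    b≡b′ : b ≡ b′
    b≡b′ = toℕ-%≡⇒≡ (+-cancelˡ-%≡ (toℕ m * toℕ x)
             (trans (sym on₁) (trans on₁′ (cong (λ z → (toℕ z * toℕ x + toℕ b′) % q) (sym m≡m′)))))

  common-line-unique : Prime q → (p p′ : Point q) → p ≢ p′ → (L L′ : Line q) →
                       p ∈L L → p′ ∈L L → p ∈L L′ → p′ ∈L L′ → L ≡ L′
  common-line-unique q-prime (x , y) (x′ , y′) p≢p′ L L′ on₁ on₂ on₁′ on₂′ with <-cmp (toℕ x) (toℕ x′)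
  ... | tri< x<x′ _ _ = line-through-two-columns q-prime x<x′ on₁ on₂ on₁′ on₂′
  ... | tri> _ _ x′<x = line-through-two-columns q-prime x′<x on₂ on₁ on₂′ on₁′
  ... | tri≈ _ x≡x′ _ with refl ← toℕ-injective x≡x′ =
    contradiction (cong (x ,_) (toℕ-injective (trans on₁ (sym on₂)))) p≢p′

  hitting≥q²/2 : Prime q → (A : Point q → Bool) → card A ≡ q → 2 * hitting A ≥ q * q
  hitting≥q²/2 q-prime A |A|≡q = m≤n+o∧2o≤m⇒m≤2n {n = hitting A} {o = q C 2}
                                   (subst (q * q ≤_) hits≡hitting bound) 2qC2≤q*q
    where
    open LinearHypergraph inc (lines q)
    S = filterᵇ A (points q)
    common≤1 : ∀ {p p′} → p ≢ p′ → count (λ l → inc p l ∧ inc p′ l) (lines q) ≤ 1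
    common≤1 {p} {p′} p≢p′ = count-≤1 _ grid-unique λ {L} {L′} t t′ →
      let (on₁ , on₂) = Equivalence.to (T-∧ {inc p L}) t
          (on₁′ , on₂′) = Equivalence.to (T-∧ {inc p L′}) t′
      in common-line-unique q-prime p p′ p≢p′ L L′ (toWitness on₁) (toWitness on₂) (toWitness on₁′) (toWitness on₂′)
    bound : q * q ≤ hits S + q C 2
    bound = subst (λ n → n * q ≤ hits S + n C 2) |A|≡q
              (hits-lowerBound degree≡q common≤1 S (filter⁺ (T? ∘ A) grid-unique))
    hits≡hitting : hits S + q C 2 ≡ hitting A + q C 2
    hits≡hitting = cong (_+ q C 2) (sym (count-cong (λ L → any-filterᵇ A (λ p → inc p L) (points q)) (lines q)))
    2qC2≤q*q : 2 * (q C 2) ≤ q * q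
    2qC2≤q*q = subst (2 * (q C 2) ≤_) (2*nC2+n≡n*n q) (m≤m+n _ q)

lemma4 : (q : ℕ) .{{_ : NonZero q}} → Prime q →
    ((L : Line q) → size L ≡ q)
    × ((p : Point q) → degree p ≡ q)
    × ((p p′ : Point q) → p ≢ p′ → (L L′ : Line q) →
    p ∈L L → p′ ∈L L → p ∈L L′ → p′ ∈L L′ → L ≡ L′)
    × ((A : Point q → Bool) → card A ≡ q → 2 * hitting A ≥ q * q)
lemma4 q q-prime = size≡q , degree≡q , common-line-unique q-prime , hitting≥q²/2 q-prime
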